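{- For each integer $k\geq 3$ there exists a constant $C_k>0$ such that for every positive integer $n$ there is a maximal $k$-wise intersecting family $\mathcal{F}$ of subsets of $[n]=\{1,2,\dots,n\}$ with $|\mathcal{F}|\leq C_k\cdot 2^{n/(k-1)}$.
   Context: A family $\mathcal{F}$ of subsets of $[n]$ is called $k$-wise intersecting if for all (not necessarily distinct) $X_1,\dots,X_k\in\mathcal{F}$ we have $X_1\cap\dots\cap X_k\neq\emptyset$. It is called maximal $k$-wise intersecting if it is $k$-wise intersecting and no family $\mathcal{F}'$ of subsets of $[n]$ strictly containing $\mathcal{F}$ is $k$-wise intersecting. -}

module Defs where

open import Data.Nat using (ℕ)
open import Data.Fin using (Fin)
open import Data.Fin.Subset using (Subset; ⋂; Nonempty)
open import Data.List using (List; tabulate)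
open import Data.List.Membership.Propositional using (_∈_)
open import Data.List.Relation.Binary.Subset.Propositional using (_⊆_)
open import Data.Product using (Σ; _×_)
open import Relation.Nullary using (¬_)

Family : ℕ → Set
Family n = List (Subset n)

-- k-wise intersecting: any k (not necessarily distinct) members intersect.
KWiseIntersecting : ∀ {n} → ℕ → Family n → Set
KWiseIntersecting {n} k F =
  (X : Fin k → Subset n) → (∀ i → X i ∈ F) → Nonempty (⋂ (tabulate X))

StrictSuperfamily : ∀ {n} → Family n → Family n → Set
StrictSuperfamily {n} F' F = (F ⊆ F') × Σ (Subset n) (λ Y → (Y ∈ F') × ¬ (Y ∈ F))

MaximalKWiseIntersecting : ∀ {n} → ℕ → Family n → Set
MaximalKWiseIntersecting {n} k F =
  KWiseIntersecting k F ×
  ((F' : Family n) → StrictSuperfamily F' F → ¬ KWiseIntersecting k F')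

-- Set aside the b = k − 1 smallest points of [m] as apexes a₀,…,a_{b−1} and split the
-- remaining points into b residue classes B₀,…,B_{b−1} modulo b. The family consists of
-- the sets X of some type i: X contains every block other than Bᵢ, and either contains
-- all apexes, or contains aᵢ and meets Bᵢ. If k members had no common point, every block
-- j would be missed by a member of type j, and chasing the missed apexes exhibits two
-- types used twice: more than b + 1 members. A set outside the family has empty
-- intersection with b suitable members of the forms "all points outside Bₗ" and "the
-- blocks other than Bⱼ, plus x and aⱼ", so the family is maximal. A member of type i is
-- determined by its trace on Bᵢ and the apexes, so there are at most b · 2^(b + m/b + 1)
-- members. For m < 2b the star of a point is small enough instead.
module Submission where

open import Data.Bool using (Bool; true; if_then_else_)
open import Data.Empty using (⊥)
open import Data.Fin as Fin using (Fin; zero; suc)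
import Data.Fin.Properties as Finₚ
open import Data.Fin.Subset using (Subset; inside; outside; ⋂; ∁; ∣_∣; _∪_; ⁅_⁆; _∈_; _∉_; _⊆_)
open import Data.Fin.Subset.Properties
  using (_∈?_; _⊆?_; ∈⊤; x∈p∩q⁺; x∈p∩q⁻; x∈p∪q⁺; x∈p∪q⁻; x∈⁅x⁆; x∈⁅y⁆⇒x≡y; x∈∁p⇒x∉p;
         p⊆q⇒∣p∣≤∣q∣; drop-∷-⊆)
open import Data.List as List using (List; []; _∷_; _++_; map; filter; length)
open import Data.List.Membership.Propositional using () renaming (_∈_ to _∈ₗ_)
open import Data.List.Membership.Propositional.Properties
  using (∈-map⁺; ∈-map⁻; ∈-++⁺ˡ; ∈-++⁺ʳ; ∈-filter⁺; ∈-filter⁻)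
open import Data.List.Properties using (length-filter; length-++; length-map; filter-none; filter-++)
import Data.List.Relation.Unary.All as All
open import Data.List.Relation.Unary.Any using (here)
open import Data.List.Relation.Unary.Unique.Propositional using (Unique)
import Data.List.Relation.Unary.Unique.Propositional.Properties as Unique
open import Data.Nat
  using (ℕ; zero; suc; _+_; _*_; _^_; _∸_; _/_; _%_; _≤_; _≥_; _<_; _≮_; z≤n; s≤s; z<s; s<s; s<s⁻¹;
         _≟_; _<?_; NonZero)
open import Data.Nat.DivMod using (m/n*n≤m; m≡m%n+[m/n]*n; m%n<n; [m+n]%n≡m%n; m<n⇒m%n≡m)
import Data.Nat.Properties as ℕₚ
open ℕₚ
  using (≤-refl; ≤-reflexive; ≤-trans; <-≤-trans; <⇒≤; <-irrefl; ≮⇒≥; n≤1+n; m≤n⇒m≤1+n; m≤m+n;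
         m≤n*m; m≤m*n; m+n≮m; suc-injective; +-assoc; +-comm; +-suc; +-identityʳ; *-assoc;
         +-mono-≤; +-monoʳ-≤; +-monoʳ-<; *-monoˡ-≤; *-monoʳ-≤; ^-monoˡ-≤; ^-monoʳ-≤; m^n≢0;
         ^-distribˡ-+-*; ^-*-assoc; module ≤-Reasoning)
open import Algebra.Properties.CommutativeSemigroup ℕₚ.*-commutativeSemigroup using (interchange)
open import Data.Product as Product using (Σ; ∃; _×_; _,_; proj₁; proj₂)
open import Data.Sum as Sum using (_⊎_; inj₁; inj₂; [_,_])
open import Data.Sum.Properties using (≡-dec; inj₁-injective; inj₂-injective)
open import Data.Vec as Vec using ([]; _∷_)
import Data.Vec.Functional as Vector
open import Data.Vec.Functional.Properties using (updateAt-updates; updateAt-minimal)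
open import Data.Vec.Properties using (lookup∘tabulate; []=⇒lookup; lookup⇒[]=)
open import Function using (_∘_; flip; id; const; case_of_)
open import Function.Definitions using (Injective)
open import Level using (Level)
open import Relation.Binary.Definitions using (DecidableEquality)
open import Relation.Binary.PropositionalEquality
  using (_≡_; _≢_; refl; sym; trans; cong; cong₂; subst; module ≡-Reasoning)
open import Relation.Nullary using (¬_; Dec; yes; no; does; contradiction)
open import Relation.Nullary.Decidable using (_⊎-dec_; _×-dec_; ¬?; decidable-stable; dec-true)
open import Relation.Unary using (Pred; Decidable)

open import Defs

-- Families of subsets cut out by a decidable predicate

private
  variable
    m n : ℕ
    ℓ : Level

fromPred : {P : Pred (Fin n) ℓ} → Decidable P → Subset n
fromPred P? = Vec.tabulate (does ∘ P?)

module _ {P : Pred (Fin n) ℓ} (P? : Decidable P) where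

  ∈-fromPred⁺ : ∀ {x} → P x → x ∈ fromPred P?
  ∈-fromPred⁺ {x} px = lookup⇒[]= x _ (trans (lookup∘tabulate _ x) (dec-true (P? x) px))

  ∈-fromPred⁻ : ∀ {x} → x ∈ fromPred P? → P x
  ∈-fromPred⁻ {x} x∈ = witness (P? x) (trans (sym (lookup∘tabulate _ x)) ([]=⇒lookup x∈))
    where
    witness : (d : Dec (P x)) → does d ≡ true → P x
    witness (yes px) _ = px

∈-⋂⁺ : ∀ {k} (X : Fin k → Subset n) {x} → (∀ r → x ∈ X r) → x ∈ ⋂ (List.tabulate X)
∈-⋂⁺ {k = zero} X x∈ = ∈⊤
∈-⋂⁺ {k = suc k} X x∈ = x∈p∩q⁺ (x∈ zero , ∈-⋂⁺ (X ∘ suc) (x∈ ∘ suc))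

∈-⋂⁻ : ∀ {k} (X : Fin k → Subset n) {x} → x ∈ ⋂ (List.tabulate X) → ∀ r → x ∈ X r
∈-⋂⁻ {k = suc k} X x∈ zero = proj₁ (x∈p∩q⁻ (X zero) _ x∈)
∈-⋂⁻ {k = suc k} X x∈ (suc r) = ∈-⋂⁻ (X ∘ suc) (proj₂ (x∈p∩q⁻ (X zero) _ x∈)) r

allSubsets : ∀ n → List (Subset n)
allSubsets zero = [] ∷ []
allSubsets (suc n) = map (inside ∷_) (allSubsets n) ++ map (outside ∷_) (allSubsets n)

∈-allSubsets : (X : Subset n) → X ∈ₗ allSubsets n
∈-allSubsets [] = here refl
∈-allSubsets (inside ∷ X) = ∈-++⁺ˡ (∈-map⁺ (inside ∷_) (∈-allSubsets X))
∈-allSubsets {suc n} (outside ∷ X) =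
  ∈-++⁺ʳ (map (inside ∷_) (allSubsets n)) (∈-map⁺ (outside ∷_) (∈-allSubsets X))

allSubsets-unique : ∀ n → Unique (allSubsets n)
allSubsets-unique zero = All.[] Unique.∷ Unique.[]
allSubsets-unique (suc n) =
  Unique.++⁺ (Unique.map⁺ ∷-injectiveʳ (allSubsets-unique n))
             (Unique.map⁺ ∷-injectiveʳ (allSubsets-unique n)) different-heads
  where
  ∷-injectiveʳ : ∀ {s} {X Y : Subset n} → s ∷ X ≡ s ∷ Y → X ≡ Y
  ∷-injectiveʳ refl = refl
  different-heads : ∀ {Z} → ¬ (Z ∈ₗ map (inside ∷_) (allSubsets n) × Z ∈ₗ map (outside ∷_) (allSubsets n))
  different-heads (p , q) with ∈-map⁻ (inside ∷_) p | ∈-map⁻ (outside ∷_) q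
  ... | _ , _ , refl | _ , _ , ()

length-allSubsets : ∀ n → length (allSubsets n) ≡ 2 ^ n
length-allSubsets zero = refl
length-allSubsets (suc n) = begin
  length (map (inside ∷_) S ++ map (outside ∷_) S) ≡⟨ length-++ (map (inside ∷_) S) ⟩
  length (map (inside ∷_) S) + length (map (outside ∷_) S)
    ≡⟨ cong₂ _+_ (length-map _ S) (length-map _ S) ⟩
  length S + length S ≡⟨ cong (λ l → l + l) (length-allSubsets n) ⟩
  2 ^ n + 2 ^ n ≡⟨ cong (2 ^ n +_) (sym (+-identityʳ (2 ^ n))) ⟩
  2 ^ suc n ∎
  where
  open ≡-Reasoning
  S = allSubsets n

Blocker : ∀ {b} → Subset n → (Fin b → Subset n) → Set
Blocker Y M = ∀ {z} → z ∈ Y → (∀ l → z ∈ M l) → ⊥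

module FamilyOf {P : Pred (Subset n) ℓ} (P? : Decidable P) where

  family : Family n
  family = filter P? (allSubsets n)

  family-unique : Unique family
  family-unique = Unique.filter⁺ P? (allSubsets-unique n)

  ∈-family⁺ : ∀ {X} → P X → X ∈ₗ family
  ∈-family⁺ {X} = ∈-filter⁺ P? (∈-allSubsets X)

  ∈-family⁻ : ∀ {X} → X ∈ₗ family → P X
  ∈-family⁻ = proj₂ ∘ ∈-filter⁻ P? {xs = allSubsets n}

  family-intersecting : ∀ k → (∀ X → (∀ r → P (X r)) → ∃ λ z → ∀ r → z ∈ X r) →
                        KWiseIntersecting k family
  family-intersecting k common X X∈ =
    let z , z∈ = common X (∈-family⁻ ∘ X∈) in z , ∈-⋂⁺ X z∈

  Blockable : ℕ → Subset n → Set _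
  Blockable b Y = Σ (Fin b → Subset n) λ M → (∀ l → P (M l)) × Blocker Y M

  family-maximal : ∀ b → (∀ Y → ¬ P Y → Blockable b Y) →
                   (F : Family n) → StrictSuperfamily F family → ¬ KWiseIntersecting (suc b) F
  family-maximal b blocker F (family⊆F , Y , Y∈F , Y∉family) intersecting
    with P? Y
  ... | yes PY = Y∉family (∈-family⁺ PY)
  ... | no ¬PY =
    let M , PM , blocks = blocker Y ¬PY
        z , z∈ = intersecting (Y Vector.∷ M) λ { zero → Y∈F ; (suc l) → family⊆F (∈-family⁺ (PM l)) }
        z∈YM = ∈-⋂⁻ (Y Vector.∷ M) z∈
    in blocks (z∈YM zero) (z∈YM ∘ suc)

-- Counting

module _ {a p q r} {A : Set a} {P : Pred A p} {Q : Pred A q} {R : Pred A r}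
         (P? : Decidable P) (Q? : Decidable Q) (R? : Decidable R) where

  length-filter-⊎ : (∀ {x} → P x → Q x ⊎ R x) → ∀ xs →
                    length (filter P? xs) ≤ length (filter Q? xs) + length (filter R? xs)
  length-filter-⊎ P⇒Q⊎R [] = z≤n
  length-filter-⊎ P⇒Q⊎R (x ∷ xs) with ih ← length-filter-⊎ P⇒Q⊎R xs | P? x | Q? x | R? x
  ... | no _   | no _   | no _  = ih
  ... | no _   | yes _  | no _  = m≤n⇒m≤1+n ih
  ... | no _   | no _   | yes _ = ≤-trans ih (+-monoʳ-≤ _ (n≤1+n _))
  ... | no _   | yes _  | yes _ = m≤n⇒m≤1+n (≤-trans ih (+-monoʳ-≤ _ (n≤1+n _)))
  ... | yes _  | yes _  | no _  = s≤s ih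
  ... | yes _  | yes _  | yes _ = s≤s (≤-trans ih (+-monoʳ-≤ _ (n≤1+n _)))
  ... | yes _  | no _   | yes _ = ≤-trans (s≤s ih) (≤-reflexive (sym (+-suc _ _)))
  ... | yes px | no ¬qx | no ¬rx = [ flip contradiction ¬qx , flip contradiction ¬rx ] (P⇒Q⊎R px)

module _ {a p q} {A : Set a} {P : Pred A p} {Q : Pred A q} (P? : Decidable P) (Q? : Decidable Q) where

  length-filter-mono : (∀ {x} → P x → Q x) → ∀ xs → length (filter P? xs) ≤ length (filter Q? xs)
  length-filter-mono P⇒Q [] = z≤n
  length-filter-mono P⇒Q (x ∷ xs) with ih ← length-filter-mono P⇒Q xs | P? x | Q? x
  ... | no _  | no _    = ih
  ... | no _  | yes _   = m≤n⇒m≤1+n ih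
  ... | yes _ | yes _   = s≤s ih
  ... | yes px | no ¬qx = contradiction (P⇒Q px) ¬qx

length-filter-map : ∀ {a b p} {A : Set a} {B : Set b} {P : Pred B p} (P? : Decidable P) (f : A → B) xs →
                    length (filter P? (map f xs)) ≡ length (filter (P? ∘ f) xs)
length-filter-map P? f [] = refl
length-filter-map P? f (x ∷ xs) with P? (f x)
... | yes _ = cong suc (length-filter-map P? f xs)
... | no _  = length-filter-map P? f xs

length-filter-∃ : ∀ {a p q} {A : Set a} {P : Pred A p} (P? : Decidable P) b {Q : Fin b → Pred A q}
                  (Q? : ∀ i → Decidable (Q i)) {K} → (∀ {x} → P x → ∃ λ i → Q i x) → ∀ xs →
                  (∀ i → length (filter (Q? i) xs) ≤ K) → length (filter P? xs) ≤ b * K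
length-filter-∃ P? zero Q? P⇒∃Q xs _ =
  ≤-reflexive (cong length (filter-none P? (All.universal (λ x px → case P⇒∃Q px of λ ()) xs)))
length-filter-∃ {P = P} P? (suc b) {Q} Q? {K} P⇒∃Q xs bounded = begin
  length (filter P? xs)                        ≤⟨ length-filter-⊎ P? (Q? zero) Q⁺? split xs ⟩
  length (filter (Q? zero) xs) + length (filter Q⁺? xs)
    ≤⟨ +-mono-≤ (bounded zero) (length-filter-∃ Q⁺? b (Q? ∘ suc) id xs (bounded ∘ suc)) ⟩
  K + b * K                                    ∎
  where
  open ≤-Reasoning
  Q⁺? : Decidable (λ x → ∃ λ i → Q (suc i) x)
  Q⁺? x = Finₚ.any? (λ i → Q? (suc i) x)
  split : ∀ {x} → P x → Q zero x ⊎ ∃ λ i → Q (suc i) x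
  split px with P⇒∃Q px
  ... | zero  , q = inj₁ q
  ... | suc i , q = inj₂ (i , q)

length-filter-⊇ : (O : Subset n) → length (filter (O ⊆?_) (allSubsets n)) ≤ 2 ^ ∣ ∁ O ∣
length-filter-⊇ [] = ≤-refl
length-filter-⊇ {suc n} (o ∷ O) = begin
  length (filter (o ∷ O ⊆?_) (map (inside ∷_) S ++ map (outside ∷_) S))
    ≡⟨ cong length (filter-++ (o ∷ O ⊆?_) (map (inside ∷_) S) _) ⟩
  length (filter (o ∷ O ⊆?_) (map (inside ∷_) S) ++ filter (o ∷ O ⊆?_) (map (outside ∷_) S))
    ≡⟨ length-++ (filter (o ∷ O ⊆?_) (map (inside ∷_) S)) ⟩
  length (filter (o ∷ O ⊆?_) (map (inside ∷_) S)) + length (filter (o ∷ O ⊆?_) (map (outside ∷_) S))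
    ≤⟨ +-mono-≤ (branch≤ o inside) (outside-branch≤ o) ⟩
  2 ^ ∣ ∁ O ∣ + outside-bound o
    ≤⟨ branches≤ o ⟩
  2 ^ ∣ ∁ (o ∷ O) ∣ ∎
  where
  open ≤-Reasoning
  S = allSubsets n
  branch≤ : ∀ o s → length (filter (o ∷ O ⊆?_) (map (s ∷_) S)) ≤ 2 ^ ∣ ∁ O ∣
  branch≤ o s = begin
    length (filter (o ∷ O ⊆?_) (map (s ∷_) S)) ≡⟨ length-filter-map (o ∷ O ⊆?_) (s ∷_) S ⟩
    length (filter ((o ∷ O ⊆?_) ∘ (s ∷_)) S)   ≤⟨ length-filter-mono _ (O ⊆?_) drop-∷-⊆ S ⟩
    length (filter (O ⊆?_) S)                  ≤⟨ length-filter-⊇ O ⟩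
    2 ^ ∣ ∁ O ∣                                ∎
  outside-bound : Bool → ℕ
  outside-bound inside = 0
  outside-bound outside = 2 ^ ∣ ∁ O ∣
  outside-branch≤ : ∀ o → length (filter (o ∷ O ⊆?_) (map (outside ∷_) S)) ≤ outside-bound o
  outside-branch≤ inside = ≤-reflexive (trans (length-filter-map (inside ∷ O ⊆?_) (outside ∷_) S)
    (cong length (filter-none _ (All.universal (λ X sub → case sub {zero} Vec.here of λ ()) S))))
  outside-branch≤ outside = branch≤ outside outside
  branches≤ : ∀ o → 2 ^ ∣ ∁ O ∣ + outside-bound o ≤ 2 ^ ∣ ∁ (o ∷ O) ∣
  branches≤ inside = ≤-reflexive (+-identityʳ _)
  branches≤ outside = ≤-reflexive (cong (2 ^ ∣ ∁ O ∣ +_) (sym (+-identityʳ _)))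

count< : ∀ {q} {Q : Pred ℕ q} → Decidable Q → ℕ → ℕ
count< Q? zero = zero
count< Q? (suc N) = (if does (Q? 0) then suc else id) (count< (Q? ∘ suc) N)

∣fromPred∘toℕ∣ : ∀ {q} {Q : Pred ℕ q} m (Q? : Decidable Q) → ∣ fromPred {m} (Q? ∘ Fin.toℕ) ∣ ≡ count< Q? m
∣fromPred∘toℕ∣ zero Q? = refl
∣fromPred∘toℕ∣ (suc m) Q? with ih ← ∣fromPred∘toℕ∣ m (Q? ∘ suc) | Q? 0
... | yes _ = cong suc ih
... | no _  = ih

count<-+ : ∀ {q} {Q : Pred ℕ q} (Q? : Decidable Q) A B → count< Q? (A + B) ≡ count< Q? A + count< (Q? ∘ (A +_)) B
count<-+ Q? zero B = refl
count<-+ Q? (suc A) B with ih ← count<-+ (Q? ∘ suc) A B | Q? 0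
... | yes _ = cong suc ih
... | no _  = ih

count<-mono : ∀ {p q} {P : Pred ℕ p} {Q : Pred ℕ q} (P? : Decidable P) (Q? : Decidable Q) N → (∀ {t} → t < N → P t → Q t) →
              count< P? N ≤ count< Q? N
count<-mono P? Q? zero P⇒Q = z≤n
count<-mono P? Q? (suc N) P⇒Q with ih ← count<-mono (P? ∘ suc) (Q? ∘ suc) N (P⇒Q ∘ s<s) | P? 0 | Q? 0
... | no _   | no _   = ih
... | no _   | yes _  = m≤n⇒m≤1+n ih
... | yes _  | yes _  = s≤s ih
... | yes p0 | no ¬q0 = contradiction (P⇒Q z<s p0) ¬q0

count<-⊎ : ∀ {p q} {P : Pred ℕ p} {Q : Pred ℕ q} (P? : Decidable P) (Q? : Decidable Q) N →
           count< (λ t → P? t ⊎-dec Q? t) N ≤ count< P? N + count< Q? N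
count<-⊎ P? Q? zero = z≤n
count<-⊎ P? Q? (suc N) with ih ← count<-⊎ (P? ∘ suc) (Q? ∘ suc) N | P? 0 | Q? 0
... | no _  | no _  = ih
... | no _  | yes _ = ≤-trans (s≤s ih) (≤-reflexive (sym (+-suc _ _)))
... | yes _ | no _  = s≤s ih
... | yes _ | yes _ = s≤s (≤-trans ih (+-monoʳ-≤ _ (n≤1+n _)))

count<-< : ∀ N c → count< (_<? c) N ≤ c
count<-< zero c = z≤n
count<-< (suc N) zero = ≤-trans (count<-mono _ (_<? 0) N (λ _ ())) (count<-< N zero)
count<-< (suc N) (suc c) = s≤s (≤-trans (count<-mono _ (_<? c) N (λ _ → s<s⁻¹)) (count<-< N c))

count<-≡ : ∀ N c → count< (_≟ c) N ≤ 1
count<-≡ zero c = z≤n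
count<-≡ (suc N) zero = s≤s (≤-trans (count<-mono _ (_<? 0) N (λ _ ())) (count<-< N zero))
count<-≡ (suc N) (suc c) = ≤-trans (count<-mono _ (_≟ c) N (λ _ → suc-injective)) (count<-≡ N c)

module _ (b : ℕ) .{{_ : NonZero b}} (i : ℕ) where

  residue? : Decidable (λ t → t % b ≡ i)
  residue? t = t % b ≟ i

  count<-residue-short : ∀ r → r ≤ b → count< residue? r ≤ 1
  count<-residue-short r r≤b = ≤-trans
    (count<-mono residue? (_≟ i) r (λ t<r t%b≡i → trans (sym (m<n⇒m%n≡m (<-≤-trans t<r r≤b))) t%b≡i))
    (count<-≡ r i)

  count<-residue-+ : ∀ q r → r ≤ b → count< residue? (q * b + r) ≤ suc q
  count<-residue-+ zero r r≤b = count<-residue-short r r≤b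
  count<-residue-+ (suc q) r r≤b = begin
    count< residue? (b + q * b + r)         ≡⟨ cong (count< residue?) (+-assoc b (q * b) r) ⟩
    count< residue? (b + (q * b + r))       ≡⟨ count<-+ residue? b (q * b + r) ⟩
    count< residue? b + count< (residue? ∘ (b +_)) (q * b + r)
      ≤⟨ +-mono-≤ (count<-residue-short b ≤-refl)
                  (count<-mono _ residue? (q * b + r) (λ _ → trans (sym (periodic _)))) ⟩
    1 + count< residue? (q * b + r)         ≤⟨ s≤s (count<-residue-+ q r r≤b) ⟩
    suc (suc q)                             ∎
    where
    open ≤-Reasoning
    periodic : ∀ t → (b + t) % b ≡ t % b
    periodic t = trans (cong (_% b) (+-comm b t)) ([m+n]%n≡m%n t b)

  count<-residue : ∀ N → count< residue? N ≤ suc (N / b)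
  count<-residue N = begin
    count< residue? N                      ≡⟨ cong (count< residue?) N≡ ⟩
    count< residue? (N / b * b + N % b)    ≤⟨ count<-residue-+ (N / b) (N % b) (<⇒≤ (m%n<n N b)) ⟩
    suc (N / b)                            ∎
    where
    open ≤-Reasoning
    N≡ : N ≡ N / b * b + N % b
    N≡ = trans (m≡m%n+[m/n]*n N b) (+-comm (N % b) _)

∷-injective : ∀ {x} {f : Fin n → Fin m} → Injective _≡_ _≡_ f → (∀ j → x ≢ f j) →
              Injective _≡_ _≡_ (x Vector.∷ f)
∷-injective f-inj x∉f {zero}  {zero}  _  = refl
∷-injective f-inj x∉f {zero}  {suc j} eq = contradiction eq (x∉f j)
∷-injective f-inj x∉f {suc i} {zero}  eq = contradiction (sym eq) (x∉f i)
∷-injective f-inj x∉f {suc i} {suc j} eq = cong suc (f-inj eq)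

two-outside-image : ∀ {b} {κ : Fin b → Fin n} {ν ν′} → Injective _≡_ _≡_ κ →
                    (∀ j → ν ≢ κ j) → (∀ j → ν′ ≢ κ j) → ν ≢ ν′ → 2 + b ≤ n
two-outside-image κ-inj ν∉κ ν′∉κ ν≢ν′ =
  Finₚ.injective⇒≤ (∷-injective (∷-injective κ-inj ν′∉κ) λ { zero → ν≢ν′ ; (suc j) → ν∉κ j })

-- The construction

updateAt-const-∀ : ∀ {a p} {A : Set a} {P : Pred A p} (xs : Fin n → A) i {x} →
                   (∀ l → P (xs l)) → P x → ∀ l → P (Vector.updateAt xs i (const x) l)
updateAt-const-∀ {P = P} xs i P-xs Px l with l Fin.≟ i
... | yes refl = subst P (sym (updateAt-updates i xs)) Px
... | no l≢i   = subst P (sym (updateAt-minimal l i xs l≢i)) (P-xs l)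

Label : ℕ → Set
Label b = Fin b ⊎ Fin b

pattern apex j = inj₁ j
pattern block l = inj₂ l

_≟ᴸ_ : ∀ {b} → DecidableEquality (Label b)
_≟ᴸ_ = ≡-dec Fin._≟_ Fin._≟_

record Layout (b m : ℕ) : Set where
  field
    label            : Fin m → Label b
    apexPoint        : Fin b → Fin m
    label-apexPoint  : ∀ j → label (apexPoint j) ≡ apex j
    apexPoint-unique : ∀ {x j} → label x ≡ apex j → x ≡ apexPoint j
    blockPoint       : Fin b → Fin m
    label-blockPoint : ∀ l → label (blockPoint l) ≡ block l

module Construction {b m} (L : Layout b m) where

  open Layout L

  InOtherBlock : Fin b → Fin m → Set
  InOtherBlock i x = ∃ λ l → label x ≡ block l × l ≢ i

  inOtherBlock? : ∀ i → Decidable (InOtherBlock i)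
  inOtherBlock? i x = Finₚ.any? λ l → (label x ≟ᴸ block l) ×-dec ¬? (l Fin.≟ i)

  Rest : Fin b → Subset m
  Rest i = fromPred (inOtherBlock? i)

  ∈-Rest⁺ : ∀ {i x l} → label x ≡ block l → l ≢ i → x ∈ Rest i
  ∈-Rest⁺ {i} {x} {l} lx l≢i = ∈-fromPred⁺ (inOtherBlock? i) (l , lx , l≢i)

  ∈-Rest⁻ : ∀ {i x} → x ∈ Rest i → InOtherBlock i x
  ∈-Rest⁻ {i} = ∈-fromPred⁻ (inOtherBlock? i)

  AllApexes : Subset m → Set
  AllApexes X = ∀ j → apexPoint j ∈ X

  MeetsBlock : Fin b → Subset m → Set
  MeetsBlock i X = ∃ λ x → label x ≡ block i × x ∈ X

  OfType : Fin b → Subset m → Set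
  OfType i X = Rest i ⊆ X × (AllApexes X ⊎ (MeetsBlock i X × apexPoint i ∈ X))

  Member : Subset m → Set
  Member X = ∃ λ i → OfType i X

  member? : Decidable Member
  member? X = Finₚ.any? λ i →
    (Rest i ⊆? X) ×-dec
    (Finₚ.all? (λ j → apexPoint j ∈? X) ⊎-dec
     (Finₚ.any? (λ x → (label x ≟ᴸ block i) ×-dec (x ∈? X)) ×-dec (apexPoint i ∈? X)))

  open FamilyOf member? public using (family; family-unique; family-intersecting; family-maximal; Blockable)

  common-point : (X : Fin (suc b) → Subset m) → (∀ r → Member (X r)) → ∃ λ z → ∀ r → z ∈ X r
  common-point X X-member =
    decidable-stable (Finₚ.any? λ z → Finₚ.all? λ r → z ∈? X r) no-common-point⇒⊥
    where
    type : Fin (suc b) → Fin b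
    type r = proj₁ (X-member r)

    Rest⊆X : ∀ r → Rest (type r) ⊆ X r
    Rest⊆X r = proj₁ (proj₂ (X-member r))

    no-common-point⇒⊥ : ¬ ∃ (λ z → ∀ r → z ∈ X r) → ⊥
    no-common-point⇒⊥ no-common = <-irrefl refl b+2≤b+1
      where
      missed : ∀ z → ∃ λ r → z ∉ X r
      missed z = Finₚ.¬∀⟶∃¬ _ _ (λ r → z ∈? X r) (λ z∈ → no-common (z , z∈))

      missed⇒type : ∀ {r z j} → label z ≡ block j → z ∉ X r → type r ≡ j
      missed⇒type {r} {z} {j} lz z∉ with type r Fin.≟ j
      ... | yes type≡j = type≡j
      ... | no type≢j = contradiction (Rest⊆X r (∈-Rest⁺ lz (type≢j ∘ sym))) z∉

      κ : Fin b → Fin (suc b)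
      κ j = proj₁ (missed (blockPoint j))

      type∘κ : ∀ j → type (κ j) ≡ j
      type∘κ j = missed⇒type (label-blockPoint j) (proj₂ (missed (blockPoint j)))

      κ-injective : Injective _≡_ _≡_ κ
      κ-injective {j} {j′} eq = trans (sym (type∘κ j)) (trans (cong type eq) (type∘κ j′))

      outside-κ : ∀ {ν} → ν ≢ κ (type ν) → ∀ j → ν ≢ κ j
      outside-κ ν≢ j refl = ν≢ (cong κ (sym (type∘κ j)))

      -- The member X λ₀ missing aⱼ has a type i ≠ j, contains aᵢ and meets Bᵢ at some x;
      -- the member X μ missing x has type i as well, and λ₀, μ cannot both be κ i.
      extra-index : ∀ j → ∃ λ ν → type ν ≢ j × ν ≢ κ (type ν)
      extra-index j with missed (apexPoint j)
      ... | λ₀ , aⱼ∉ with proj₂ (proj₂ (X-member λ₀))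
      ...   | inj₁ all-apexes = contradiction (all-apexes j) aⱼ∉
      ...   | inj₂ ((x , lx , x∈) , aᵢ∈) with missed x | λ₀ Fin.≟ κ (type λ₀)
      ...     | _ , _ | no λ₀≢ = λ₀ , type-λ₀≢j , λ₀≢
        where
        type-λ₀≢j : type λ₀ ≢ j
        type-λ₀≢j refl = aⱼ∉ aᵢ∈
      ...     | μ , x∉ | yes λ₀≡ = μ , type-μ≢j , μ≢
        where
        type-μ≡ : type μ ≡ type λ₀
        type-μ≡ = missed⇒type lx x∉
        type-μ≢j : type μ ≢ j
        type-μ≢j type-μ≡j = aⱼ∉ (subst (λ i → apexPoint i ∈ X λ₀) (trans (sym type-μ≡) type-μ≡j) aᵢ∈)
        μ≢ : μ ≢ κ (type μ)
        μ≢ μ≡ = x∉ (subst (λ r → x ∈ X r) (sym (trans μ≡ (trans (cong κ type-μ≡) (sym λ₀≡)))) x∈)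

      b+2≤b+1 : 2 + b ≤ suc b
      b+2≤b+1 =
        let ν  , _       , ν≢  = extra-index (type zero)
            ν′ , type≢ , ν′≢ = extra-index (type ν)
        in two-outside-image κ-injective (outside-κ ν≢) (outside-κ ν′≢) (λ ν≡ν′ → type≢ (cong type (sym ν≡ν′)))

  label-cases : ∀ z → (∃ λ j → z ≡ apexPoint j) ⊎ (∃ λ l → label z ≡ block l)
  label-cases z with label z in lz
  ... | apex j  = inj₁ (j , apexPoint-unique lz)
  ... | block l = inj₂ (l , refl)

  AllBut : Fin b → Subset m
  AllBut l = fromPred λ x → ¬? (label x ≟ᴸ block l)

  ∈-AllBut⁻ : ∀ {l z} → z ∈ AllBut l → label z ≢ block l
  ∈-AllBut⁻ {l} = ∈-fromPred⁻ (λ x → ¬? (label x ≟ᴸ block l))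

  AllBut-ofType : ∀ l → OfType l (AllBut l)
  AllBut-ofType l = (λ x∈ → let l′ , lx , l′≢l = ∈-Rest⁻ x∈ in in-AllBut λ eq → l′≢l (inj₂-injective (trans (sym lx) eq)))
                , inj₁ λ j → in-AllBut λ eq → case trans (sym (label-apexPoint j)) eq of λ ()
    where
    in-AllBut : ∀ {x} → label x ≢ block l → x ∈ AllBut l
    in-AllBut = ∈-fromPred⁺ (λ x → ¬? (label x ≟ᴸ block l))

  AllBut-member : ∀ l → Member (AllBut l)
  AllBut-member l = l , AllBut-ofType l

  Around : Fin b → Fin m → Subset m
  Around j x = Rest j ∪ ⁅ x ⁆ ∪ ⁅ apexPoint j ⁆

  Around-ofType : ∀ {j x} → label x ≡ block j → OfType j (Around j x)
  Around-ofType {j} {x} lx = (λ z∈ → x∈p∪q⁺ (inj₁ z∈))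
                         , inj₂ ((x , lx , x∈p∪q⁺ (inj₂ (x∈p∪q⁺ (inj₁ (x∈⁅x⁆ x)))))
                                , x∈p∪q⁺ (inj₂ (x∈p∪q⁺ (inj₂ (x∈⁅x⁆ (apexPoint j))))))

  ∈-Around⁻ : ∀ {j x z} → z ∈ Around j x → InOtherBlock j z ⊎ z ≡ x ⊎ z ≡ apexPoint j
  ∈-Around⁻ {j} {x} z∈ with x∈p∪q⁻ (Rest j) _ z∈
  ... | inj₁ z∈r = inj₁ (∈-Rest⁻ z∈r)
  ... | inj₂ z∈′ = inj₂ (Sum.map (x∈⁅y⁆⇒x≡y _) (x∈⁅y⁆⇒x≡y _) (x∈p∪q⁻ ⁅ x ⁆ _ z∈′))

  apex-∈-Around : ∀ {j j′ x} → label x ≡ block j → apexPoint j′ ∈ Around j x → j′ ≡ j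
  apex-∈-Around {j} {j′} lx a∈ with ∈-Around⁻ a∈
  ... | inj₁ (l , la , _) = case trans (sym (label-apexPoint j′)) la of λ ()
  ... | inj₂ (inj₁ refl) = case trans (sym (label-apexPoint j′)) lx of λ ()
  ... | inj₂ (inj₂ eq) = inj₁-injective (trans (sym (label-apexPoint j′)) (trans (cong label eq) (label-apexPoint j)))

  block-∈-Around : ∀ {j x z} → label z ≡ block j → z ∈ Around j x → z ≡ x
  block-∈-Around {j} lz z∈ with ∈-Around⁻ z∈
  ... | inj₁ (l , lz′ , l≢j) = contradiction (inj₂-injective (trans (sym lz′) lz)) l≢j
  ... | inj₂ (inj₁ z≡x) = z≡x
  ... | inj₂ (inj₂ refl) = case trans (sym (label-apexPoint j)) lz of λ ()

  module _ {Y : Subset m} where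

    blockable-via-Around : ∀ i {j x} → label x ≡ block j → apexPoint j ∉ Y →
                    (∀ {z} → label z ≡ block i → z ∈ Y → z ∈ Around j x → ⊥) → Blockable b Y
    blockable-via-Around i {j} {x} lx aⱼ∉ no-block-i =
      M , updateAt-const-∀ {P = Member} AllBut i AllBut-member (j , Around-ofType lx) , blocks
      where
      M = Vector.updateAt AllBut i (const (Around j x))
      blocks : Blocker Y M
      blocks {z} z∈Y z∈M with z∈Around ← subst (z ∈_) (updateAt-updates i AllBut) (z∈M i) | label-cases z
      ... | inj₁ (j′ , refl) = aⱼ∉ (subst (λ j → apexPoint j ∈ Y) (apex-∈-Around lx z∈Around) z∈Y)
      ... | inj₂ (l , lz) with l Fin.≟ i
      ...   | yes refl = no-block-i lz z∈Y z∈Around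
      ...   | no l≢i = ∈-AllBut⁻ (subst (z ∈_) (updateAt-minimal l i AllBut l≢i) (z∈M l)) lz

    blockable-via-two-Arounds : ∀ {i i′ x x′} → label x ≡ block i → label x′ ≡ block i′ → i ≢ i′ →
                    x ∉ Y → x′ ∉ Y → Blockable b Y
    blockable-via-two-Arounds {i} {i′} {x} {x′} lx lx′ i≢i′ x∉ x′∉ =
      M , updateAt-const-∀ {P = Member} M₁ i′ M₁-member (i′ , Around-ofType lx′) , blocks
      where
      M₁ = Vector.updateAt AllBut i (const (Around i x))
      M₁-member : ∀ l → Member (M₁ l)
      M₁-member = updateAt-const-∀ {P = Member} AllBut i AllBut-member (i , Around-ofType lx)
      M = Vector.updateAt M₁ i′ (const (Around i′ x′))
      M-i : M i ≡ Around i x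
      M-i = trans (updateAt-minimal i i′ M₁ i≢i′) (updateAt-updates i AllBut)
      M-i′ : M i′ ≡ Around i′ x′
      M-i′ = updateAt-updates i′ M₁
      blocks : Blocker Y M
      blocks {z} z∈Y z∈M
        with z∈i ← subst (z ∈_) M-i (z∈M i) | z∈i′ ← subst (z ∈_) M-i′ (z∈M i′) | label-cases z
      ... | inj₁ (j , refl) = i≢i′ (trans (sym (apex-∈-Around lx z∈i)) (apex-∈-Around lx′ z∈i′))
      ... | inj₂ (l , lz) with l Fin.≟ i | l Fin.≟ i′
      ...   | yes refl | _ = x∉ (subst (_∈ Y) (block-∈-Around lz z∈i) z∈Y)
      ...   | no _ | yes refl = x′∉ (subst (_∈ Y) (block-∈-Around lz z∈i′) z∈Y)
      ...   | no l≢i | no l≢i′ =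
        ∈-AllBut⁻ (subst (z ∈_) (trans (updateAt-minimal l i′ M₁ l≢i′) (updateAt-minimal l i AllBut l≢i)) (z∈M l)) lz

    blockable-via-AllBut : (∀ {x l} → label x ≡ block l → x ∈ Y) → ¬ Member Y → Blockable b Y
    blockable-via-AllBut blocks⊆Y ¬member = AllBut , AllBut-member , blocks
      where
      apex∉ : ∀ j → apexPoint j ∉ Y
      apex∉ j a∈ = ¬member (j , (λ x∈ → let _ , lx , _ = ∈-Rest⁻ x∈ in blocks⊆Y lx)
                               , inj₂ ((blockPoint j , label-blockPoint j , blocks⊆Y (label-blockPoint j)) , a∈))
      blocks : Blocker Y AllBut
      blocks {z} z∈Y z∈M with label-cases z
      ... | inj₁ (j , refl) = apex∉ j z∈Y
      ... | inj₂ (l , lz) = ∈-AllBut⁻ (z∈M l) lz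

  blockable : ∀ Y → ¬ Member Y → Blockable b Y
  blockable Y ¬member with Finₚ.any? (λ x → Finₚ.any? (λ l → label x ≟ᴸ block l) ×-dec ¬? (x ∈? Y))
  ... | no all-in =
    blockable-via-AllBut (λ {x} {l} lx → decidable-stable (x ∈? Y) λ x∉ → all-in (x , (l , lx) , x∉)) ¬member
  ... | yes (x , (i , lx) , x∉) with Finₚ.any? (λ x′ → (x′ ∈? Rest i) ×-dec ¬? (x′ ∈? Y))
  ...   | yes (x′ , x′∈ , x′∉) = let i′ , lx′ , i′≢i = ∈-Rest⁻ x′∈ in
    blockable-via-two-Arounds lx lx′ (i′≢i ∘ sym) x∉ x′∉
  ...   | no rest-in with apexPoint i ∈? Y
  ...     | no aᵢ∉ = blockable-via-Around i lx aᵢ∉ λ lz z∈Y z∈ → x∉ (subst (_∈ Y) (block-∈-Around lz z∈) z∈Y)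
  ...     | yes aᵢ∈ =
    let j , aⱼ∉ = Finₚ.¬∀⟶∃¬ _ _ (λ j → apexPoint j ∈? Y) (λ all → ¬member (i , Rest⊆Y , inj₁ all))
    in blockable-via-Around i (label-blockPoint j) aⱼ∉ λ lz z∈Y _ → ¬member (i , Rest⊆Y , inj₂ ((_ , lz , z∈Y) , aᵢ∈))
    where
    Rest⊆Y : Rest i ⊆ Y
    Rest⊆Y {z} z∈ = decidable-stable (z ∈? Y) λ z∉ → rest-in (z , z∈ , z∉)

  family-maximal-intersecting : MaximalKWiseIntersecting (suc b) family
  family-maximal-intersecting = family-intersecting (suc b) common-point , family-maximal b blockable

  length-family : ∀ {K} → (∀ i → ∣ ∁ (Rest i) ∣ ≤ K) → length family ≤ b * 2 ^ K
  length-family bound = length-filter-∃ member? b (λ i → Rest i ⊆?_) (Product.map₂ proj₁) (allSubsets m)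
    λ i → ≤-trans (length-filter-⊇ (Rest i)) (^-monoʳ-≤ 2 (bound i))

module ModularLayout (b m : ℕ) .{{_ : NonZero b}} (b+b≤m : b + b ≤ m) where

  labelℕ : ℕ → Label b
  labelℕ t with t <? b
  ... | yes t<b = apex (Fin.fromℕ< t<b)
  ... | no _    = block (Fin.fromℕ< (m%n<n t b))

  labelℕ-< : ∀ {t} (t<b : t < b) → labelℕ t ≡ apex (Fin.fromℕ< t<b)
  labelℕ-< {t} t<b with t <? b
  ... | yes _ = refl
  ... | no t≮b = contradiction t<b t≮b

  labelℕ-≮ : ∀ {t} → t ≮ b → labelℕ t ≡ block (Fin.fromℕ< (m%n<n t b))
  labelℕ-≮ {t} t≮b with t <? b
  ... | yes t<b = contradiction t<b t≮b
  ... | no _ = refl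

  b≤m : b ≤ m
  b≤m = ≤-trans (m≤m+n b b) b+b≤m

  b+l<m : ∀ (l : Fin b) → b + Fin.toℕ l < m
  b+l<m l = <-≤-trans (+-monoʳ-< b (Finₚ.toℕ<n l)) b+b≤m

  layout : Layout b m
  layout = record
    { label            = labelℕ ∘ Fin.toℕ
    ; apexPoint        = λ j → Fin.inject≤ j b≤m
    ; label-apexPoint  = λ j → trans (cong labelℕ (Finₚ.toℕ-inject≤ j b≤m))
                                     (trans (labelℕ-< (Finₚ.toℕ<n j)) (cong apex (Finₚ.fromℕ<-toℕ j _)))
    ; apexPoint-unique = apexPoint-unique
    ; blockPoint       = λ l → Fin.fromℕ< (b+l<m l)
    ; label-blockPoint = λ l → trans (cong labelℕ (Finₚ.toℕ-fromℕ< (b+l<m l)))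
                                     (trans (labelℕ-≮ (m+n≮m b (Fin.toℕ l))) (cong block (Finₚ.toℕ-injective (b+l%b l))))
    }
    where
    apexPoint-unique : ∀ {x j} → labelℕ (Fin.toℕ x) ≡ apex j → x ≡ Fin.inject≤ j b≤m
    apexPoint-unique {x} {j} eq with Fin.toℕ x <? b
    ... | no _ = case eq of λ ()
    ... | yes t<b = Finₚ.toℕ-injective (begin
      Fin.toℕ x                      ≡⟨ Finₚ.toℕ-fromℕ< t<b ⟨
      Fin.toℕ (Fin.fromℕ< t<b)       ≡⟨ cong Fin.toℕ (inj₁-injective eq) ⟩
      Fin.toℕ j                      ≡⟨ Finₚ.toℕ-inject≤ j b≤m ⟨
      Fin.toℕ (Fin.inject≤ j b≤m)    ∎)
      where open ≡-Reasoning
    b+l%b : ∀ (l : Fin b) → Fin.toℕ (Fin.fromℕ< (m%n<n (b + Fin.toℕ l) b)) ≡ Fin.toℕ l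
    b+l%b l = begin
      Fin.toℕ (Fin.fromℕ< (m%n<n (b + Fin.toℕ l) b)) ≡⟨ Finₚ.toℕ-fromℕ< (m%n<n (b + Fin.toℕ l) b) ⟩
      (b + Fin.toℕ l) % b                            ≡⟨ cong (_% b) (+-comm b (Fin.toℕ l)) ⟩
      (Fin.toℕ l + b) % b                            ≡⟨ [m+n]%n≡m%n (Fin.toℕ l) b ⟩
      Fin.toℕ l % b                                  ≡⟨ m<n⇒m%n≡m (Finₚ.toℕ<n l) ⟩
      Fin.toℕ l                                      ∎
      where open ≡-Reasoning

  open Construction layout public

  ∣∁Rest∣≤ : ∀ i → ∣ ∁ (Rest i) ∣ ≤ b + suc (m / b)
  ∣∁Rest∣≤ i = begin
    ∣ ∁ (Rest i) ∣                                       ≤⟨ p⊆q⇒∣p∣≤∣q∣ ∁Rest⊆ ⟩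
    ∣ fromPred {m} (apex-or-residue? ∘ Fin.toℕ) ∣        ≡⟨ ∣fromPred∘toℕ∣ m apex-or-residue? ⟩
    count< apex-or-residue? m                            ≤⟨ count<-⊎ (_<? b) (residue? b (Fin.toℕ i)) m ⟩
    count< (_<? b) m + count< (residue? b (Fin.toℕ i)) m ≤⟨ +-mono-≤ (count<-< m b) (count<-residue b (Fin.toℕ i) m) ⟩
    b + suc (m / b)                                      ∎
    where
    open ≤-Reasoning
    apex-or-residue? : Decidable (λ t → t < b ⊎ t % b ≡ Fin.toℕ i)
    apex-or-residue? t = (t <? b) ⊎-dec residue? b (Fin.toℕ i) t
    ∁Rest⊆ : ∁ (Rest i) ⊆ fromPred {m} (apex-or-residue? ∘ Fin.toℕ)
    ∁Rest⊆ {x} x∈ = ∈-fromPred⁺ (apex-or-residue? ∘ Fin.toℕ) (classify (Fin.toℕ x <? b))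
      where
      classify : Dec (Fin.toℕ x < b) → Fin.toℕ x < b ⊎ Fin.toℕ x % b ≡ Fin.toℕ i
      classify (yes x<b) = inj₁ x<b
      classify (no x≮b) with Fin.fromℕ< (m%n<n (Fin.toℕ x) b) Fin.≟ i
      ... | yes l≡i = inj₂ (trans (sym (Finₚ.toℕ-fromℕ< _)) (cong Fin.toℕ l≡i))
      ... | no l≢i = contradiction (∈-Rest⁺ (labelℕ-≮ x≮b) l≢i) (x∈∁p⇒x∉p x∈)

  length-family≤ : length family ≤ b * 2 ^ (b + suc (m / b))
  length-family≤ = length-family ∣∁Rest∣≤

module Star (n : ℕ) where

  open FamilyOf {suc n} (zero ∈?_) public using (family; family-unique)
  open FamilyOf {suc n} (zero ∈?_) using (family-intersecting; family-maximal)

  family-maximal-intersecting : ∀ b → MaximalKWiseIntersecting (suc (suc b)) family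
  family-maximal-intersecting b =
    family-intersecting _ (λ X 0∈X → zero , 0∈X) ,
    family-maximal (suc b) λ Y 0∉Y → (λ _ → ⁅ zero ⁆) , (λ _ → x∈⁅x⁆ zero) ,
                                     λ z∈Y z∈M → 0∉Y (subst (_∈ Y) (x∈⁅y⁆⇒x≡y zero (z∈M zero)) z∈Y)

  length-family≤ : length family ≤ 2 ^ suc n
  length-family≤ = ≤-trans (length-filter (zero ∈?_) (allSubsets (suc n))) (≤-reflexive (length-allSubsets (suc n)))

maximal-family : ∀ b n .{{_ : NonZero b}} →
                 Σ (Family (suc n)) λ F → Unique F × MaximalKWiseIntersecting (suc b) F ×
                                          length F ≤ b * 2 ^ (b + b) * 2 ^ (suc n / b)
maximal-family (suc b) n with suc n <? suc b + suc b
... | yes small = Star.family n , Star.family-unique n , Star.family-maximal-intersecting n b , (begin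
  length (Star.family n)          ≤⟨ Star.length-family≤ n ⟩
  2 ^ suc n                       ≤⟨ ^-monoʳ-≤ 2 (<⇒≤ small) ⟩
  2 ^ (suc b + suc b)             ≤⟨ m≤n*m _ (suc b) ⟩
  suc b * 2 ^ (suc b + suc b)     ≤⟨ m≤m*n _ _ {{m^n≢0 2 (suc n / suc b)}} ⟩
  suc b * 2 ^ (suc b + suc b) * 2 ^ (suc n / suc b) ∎)
  where open ≤-Reasoning
... | no large = family , family-unique , family-maximal-intersecting , (begin
  length family                                 ≤⟨ length-family≤ ⟩
  suc b * 2 ^ (suc b + suc q)                   ≡⟨ cong (λ e → suc b * 2 ^ e) (sym (+-assoc (suc b) 1 q)) ⟩
  suc b * 2 ^ (suc b + 1 + q)                   ≡⟨ cong (suc b *_) (^-distribˡ-+-* 2 (suc b + 1) q) ⟩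
  suc b * (2 ^ (suc b + 1) * 2 ^ q)             ≡⟨ *-assoc (suc b) (2 ^ (suc b + 1)) (2 ^ q) ⟨
  suc b * 2 ^ (suc b + 1) * 2 ^ q               ≤⟨ *-monoˡ-≤ (2 ^ q) (*-monoʳ-≤ (suc b) (^-monoʳ-≤ 2 (+-monoʳ-≤ (suc b) (s≤s z≤n)))) ⟩
  suc b * 2 ^ (suc b + suc b) * 2 ^ q           ∎)
  where
  open ModularLayout (suc b) (suc n) (≮⇒≥ large)
  open ≤-Reasoning
  q = suc n / suc b

^-distribʳ-* : ∀ x y k → (x * y) ^ k ≡ x ^ k * y ^ k
^-distribʳ-* x y zero = refl
^-distribʳ-* x y (suc k) = trans (cong (x * y *_) (^-distribʳ-* x y k)) (interchange x y (x ^ k) (y ^ k))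

^-bound : ∀ {L c q} b {N} → L ≤ c * 2 ^ q → q * b ≤ N → L ^ b ≤ c ^ b * 2 ^ N
^-bound {L} {c} {q} b {N} L≤ qb≤N = begin
  L ^ b               ≤⟨ ^-monoˡ-≤ b L≤ ⟩
  (c * 2 ^ q) ^ b     ≡⟨ ^-distribʳ-* c (2 ^ q) b ⟩
  c ^ b * (2 ^ q) ^ b ≡⟨ cong (c ^ b *_) (^-*-assoc 2 q b) ⟩
  c ^ b * 2 ^ (q * b) ≤⟨ *-monoʳ-≤ (c ^ b) (^-monoʳ-≤ 2 qb≤N) ⟩
  c ^ b * 2 ^ N       ∎
  where open ≤-Reasoning

theorem1 : (k : ℕ) → k ≥ 3 →
    Σ ℕ (λ C → (n : ℕ) → Σ (Family (suc n)) (λ F →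
      Unique F × MaximalKWiseIntersecting k F ×
      length F ^ (k ∸ 1) ≤ ((suc C) ^ (k ∸ 1)) * 2 ^ (suc n)))
theorem1 zero ()
theorem1 (suc zero) (s≤s ())
theorem1 (suc (suc zero)) (s≤s (s≤s ()))
theorem1 (suc b@(suc (suc _))) _ = C , λ n →
  let F , F-unique , F-maximal , F-size = maximal-family b n
  in F , F-unique , F-maximal ,
     ^-bound {q = suc n / b} b (≤-trans F-size (*-monoˡ-≤ _ (n≤1+n C))) (m/n*n≤m (suc n) b)
  where
  C = b * 2 ^ (b + b)
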